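{- For all $n\ge3$, $$|S_n(123,132,3421)|=|S_n(123,213,3421)|=3n-5.$$
   Context: Permutations are written in one-line notation. For $\pi\in S_n$ and $\sigma\in S_k$, $\pi$ contains $\sigma$ if there are indices $1\le i_1<\dots<i_k\le n$ such that $(\pi_{i_1},\dots,\pi_{i_k})$ is order-isomorphic to $\sigma$ (i.e. $\pi_{i_a}<\pi_{i_b}$ iff $\sigma_a<\sigma_b$); otherwise $\pi$ avoids $\sigma$. $S_n(\sigma_1,\dots,\sigma_r)$ denotes the set of permutations in $S_n$ avoiding each of $\sigma_1,\dots,\sigma_r$. -}

module Defs where

open import Data.Nat using (ℕ)
open import Data.Fin using (Fin; _<_; #_)
open import Data.Vec using (Vec; lookup; _∷_; [])
open import Data.List using (List; length)
open import Data.List.Membership.Propositional using (_∈_)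
open import Data.List.Relation.Unary.Unique.Propositional using (Unique)
open import Data.Product using (Σ; ∃; _×_)
open import Function.Bundles using (_⇔_)
open import Relation.Binary.PropositionalEquality using (_≡_)
open import Relation.Nullary using (¬_)

IsPerm : (n : ℕ) → Vec (Fin n) n → Set
IsPerm n π = ∀ i j → lookup π i ≡ lookup π j → i ≡ j

Contains : {n k : ℕ} → Vec (Fin n) n → Vec (Fin k) k → Set
Contains {n} {k} π σ =
  Σ (Fin k → Fin n) λ ι →
    (∀ a b → a < b → ι a < ι b) ×
    (∀ a b → (lookup π (ι a) < lookup π (ι b)) ⇔ (lookup σ a < lookup σ b))

Avoids : {n k : ℕ} → Vec (Fin n) n → Vec (Fin k) k → Set
Avoids π σ = ¬ Contains π σ

HasCard : {A : Set} → (A → Set) → ℕ → Set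
HasCard {A} P m =
  Σ (List A) λ xs → Unique xs × (∀ x → (x ∈ xs) ⇔ P x) × length xs ≡ m

InS3 : (n : ℕ) → Vec (Fin 3) 3 → Vec (Fin 3) 3 → Vec (Fin 4) 4 → Vec (Fin n) n → Set
InS3 n σ₁ σ₂ σ₃ π = IsPerm n π × Avoids π σ₁ × Avoids π σ₂ × Avoids π σ₃

-- Patterns (0-based one-line notation).
p123 : Vec (Fin 3) 3
p123 = # 0 ∷ # 1 ∷ # 2 ∷ []

p132 : Vec (Fin 3) 3
p132 = # 0 ∷ # 2 ∷ # 1 ∷ []

p213 : Vec (Fin 3) 3
p213 = # 1 ∷ # 0 ∷ # 2 ∷ []

p3421 : Vec (Fin 4) 4
p3421 = # 2 ∷ # 3 ∷ # 1 ∷ # 0 ∷ []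

-- Both classes are enumerated by where their largest entry sits.  If π avoids 123 and 132, its
-- first entry is n or n−1, for otherwise it forms 123 or 132 together with n and n−1.  Removing a
-- leading n leaves an arbitrary member of S_{n−1}(123,132,3421); removing a leading n−1 leaves a
-- member whose entries after its maximum increase, since n−1, n and a later descent would form
-- 3421.  Likewise, if π avoids 123 and 213 then n is its first or second entry, and removing a
-- second entry n leaves a member whose later entries below its first one increase.  In both cases
-- the auxiliary class T obeys the same recursion, except that a member starting with its maximum
-- must continue increasingly, which 123-avoidance allows only up to length 3.  So T has 1, 2, 3,
-- 3, … elements in lengths 1, 2, 3, 4, …, and |S_n| = |S_{n−1}| + 3 for n ≥ 4, with |S_3| = 4.

{-# OPTIONS --safe #-}
module Submission where

open import Defs
open import Data.Nat using (ℕ; zero; suc; _+_; _*_; _∸_; z≤n; s≤s; z<s; s<s)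
import Data.Nat as ℕ
import Data.Nat.Properties as ℕ
open import Data.Fin using (Fin; zero; suc; toℕ; fromℕ; inject₁; punchIn; punchOut; _<_; _≤_)
import Data.Fin.Properties as Fin
open import Data.Vec using (Vec; []; _∷_; lookup; insertAt; map; tabulate; allFin)
import Data.Vec.Properties as Vec
open import Data.Vec.Relation.Binary.Pointwise.Extensional using (ext; Pointwise-≡⇒≡)
open import Data.Vec.Relation.Unary.Linked using (Linked; [-]; _∷_)
import Data.Vec.Relation.Unary.Linked.Properties as Linked
open import Data.List using ([]; _∷_; _++_)
import Data.List as List
import Data.List.Properties as List
open import Data.List.Membership.Propositional.Properties
  using (∈-map⁺; ∈-map⁻; ∈-++⁺ˡ; ∈-++⁺ʳ; ∈-++⁻)
open import Data.List.Relation.Unary.Any using (here; there)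
open import Data.List.Relation.Unary.All using ([])
open import Data.List.Relation.Unary.AllPairs using ([]; _∷_)
import Data.List.Relation.Unary.Unique.Propositional.Properties as Unique
open import Data.Product using (∃; _×_; _,_; proj₁)
open import Data.Sum using (_⊎_; inj₁; inj₂; [_,_]) renaming (map to map-⊎)
open import Data.Empty using (⊥; ⊥-elim)
open import Function using (_∘_)
open import Function.Bundles using (_⇔_; mk⇔; Equivalence)
import Function.Properties.Equivalence as ⇔
open import Function.Definitions using (Injective)
open import Relation.Binary using (tri<; tri≈; tri>)
open import Relation.Binary.PropositionalEquality
  using (_≡_; _≢_; refl; sym; trans; cong; subst; subst₂; module ≡-Reasoning)
open import Relation.Nullary using (¬_; yes; no)

Image : {A B : Set} → (A → B) → (A → Set) → B → Set
Image f P y = ∃ λ x → P x × y ≡ f x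

module _ {A : Set} where

  HasCard-cong : {P Q : A → Set} {m : ℕ} → (∀ x → P x ⇔ Q x) → HasCard P m → HasCard Q m
  HasCard-cong P⇔Q (xs , unique , mem , len) = xs , unique , (λ x → ⇔.trans (mem x) (P⇔Q x)) , len

  HasCard-≡ : (a : A) → HasCard (_≡ a) 1
  HasCard-≡ a = a ∷ [] , [] ∷ [] , (λ x → mk⇔ (λ { (here x≡a) → x≡a ; (there ()) }) here) , refl

  HasCard-≡× : {Q : Set} (a : A) → Q → HasCard (λ x → x ≡ a × Q) 1
  HasCard-≡× a q = HasCard-cong (λ x → mk⇔ (_, q) proj₁) (HasCard-≡ a)

  HasCard-∅ : {P : A → Set} → (∀ x → ¬ P x) → HasCard P 0
  HasCard-∅ ¬P = [] , [] , (λ x → mk⇔ (λ ()) (⊥-elim ∘ ¬P x)) , refl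

  HasCard-⊎ : {P Q : A → Set} {a b : ℕ} → (∀ x → P x → Q x → ⊥) →
              HasCard P a → HasCard Q b → HasCard (λ x → P x ⊎ Q x) (a + b)
  HasCard-⊎ disjoint (xs , uxs , xs⇔P , refl) (ys , uys , ys⇔Q , refl) =
    xs ++ ys ,
    Unique.++⁺ uxs uys (λ (x∈xs , x∈ys) → disjoint _ (to (xs⇔P _) x∈xs) (to (ys⇔Q _) x∈ys)) ,
    (λ x → mk⇔ ([ inj₁ ∘ to (xs⇔P x) , inj₂ ∘ to (ys⇔Q x) ] ∘ ∈-++⁻ xs)
               [ ∈-++⁺ˡ ∘ from (xs⇔P x) , ∈-++⁺ʳ xs ∘ from (ys⇔Q x) ]) ,
    List.length-++ xs
    where open Equivalence

HasCard-Image : {A B : Set} {P : A → Set} {f : A → B} {m : ℕ} →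
                Injective _≡_ _≡_ f → HasCard P m → HasCard (Image f P) m
HasCard-Image {f = f} f-inj (xs , unique , xs⇔P , refl) =
  List.map f xs ,
  Unique.map⁺ f-inj unique ,
  (λ y → mk⇔ (λ y∈ → let x , x∈xs , y≡fx = ∈-map⁻ f y∈ in x , to (xs⇔P x) x∈xs , y≡fx)
             (λ { (x , Px , refl) → ∈-map⁺ f (from (xs⇔P x) Px) })) ,
  List.length-map f xs
  where open Equivalence

<fromℕ : ∀ {n} {x : Fin (suc n)} → x ≢ fromℕ n → x < fromℕ n
<fromℕ {x = x} x≢top = Fin.≤∧≢⇒< (Fin.≤fromℕ x) x≢top

fromℕ≮ : ∀ {n} {x : Fin (suc n)} → ¬ fromℕ n < x
fromℕ≮ {x = x} top<x = ℕ.<⇒≱ top<x (Fin.≤fromℕ x)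

module _ {n : ℕ} (w : Fin (suc n)) {j k : Fin n} where

  punchIn-mono-< : j < k → punchIn w j < punchIn w k
  punchIn-mono-< j<k = ℕ.≰⇒> (ℕ.<⇒≱ j<k ∘ Fin.punchIn-cancel-≤ w k j)

  punchIn-cancel-< : punchIn w j < punchIn w k → j < k
  punchIn-cancel-< lt = ℕ.≰⇒> (ℕ.<⇒≱ lt ∘ Fin.punchIn-mono-≤ w k j)

  punchIn-<-⇔ : (punchIn w j < punchIn w k) ⇔ (j < k)
  punchIn-<-⇔ = mk⇔ punchIn-cancel-< punchIn-mono-<

toℕ-punchIn-< : ∀ {n} (w : Fin (suc n)) (x : Fin n) → toℕ x ℕ.< toℕ w → toℕ (punchIn w x) ≡ toℕ x
toℕ-punchIn-< (suc w) zero    _         = refl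
toℕ-punchIn-< (suc w) (suc x) (s≤s x<w) = cong suc (toℕ-punchIn-< w x x<w)

toℕ-punchIn-≥ : ∀ {n} (w : Fin (suc n)) (x : Fin n) → toℕ w ℕ.≤ toℕ x →
                toℕ (punchIn w x) ≡ suc (toℕ x)
toℕ-punchIn-≥ zero    x       _         = refl
toℕ-punchIn-≥ (suc w) (suc x) (s≤s w≤x) = cong suc (toℕ-punchIn-≥ w x w≤x)

punchIn-below : ∀ {n} {w : Fin (suc n)} {x : Fin n} → toℕ x ℕ.< toℕ w → punchIn w x < w
punchIn-below {w = w} {x} x<w = subst (ℕ._< toℕ w) (sym (toℕ-punchIn-< w x x<w)) x<w

punchIn-above : ∀ {n} {w : Fin (suc n)} {x : Fin n} → toℕ w ℕ.≤ toℕ x → w < punchIn w x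
punchIn-above {w = w} {x} w≤x = subst (toℕ w ℕ.<_) (sym (toℕ-punchIn-≥ w x w≤x)) (s≤s w≤x)

punchIn≡fromℕ⇒ : ∀ {n} (w : Fin (2 + n)) {x : Fin (suc n)} →
                 punchIn w x ≡ fromℕ (suc n) → x ≡ fromℕ n
punchIn≡fromℕ⇒ zero             e = Fin.suc-injective e
punchIn≡fromℕ⇒ (suc w) {zero}   ()
punchIn≡fromℕ⇒ {suc n} (suc w) {suc x} e = cong suc (punchIn≡fromℕ⇒ w (Fin.suc-injective e))

penultimate : ∀ m → Fin (2 + m)
penultimate m = inject₁ (fromℕ m)

penultimate<fromℕ : ∀ m → penultimate m < fromℕ (suc m)
penultimate<fromℕ m = Fin.≤̄⇒inject₁< Fin.≤-refl

penultimate≢fromℕ : ∀ m → penultimate m ≢ fromℕ (suc m)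
penultimate≢fromℕ m = Fin.<⇒≢ (penultimate<fromℕ m)

penultimate-cases : ∀ m (x : Fin (2 + m)) → x < penultimate m ⊎ x ≡ penultimate m ⊎ x ≡ fromℕ (suc m)
penultimate-cases m x with x Fin.≟ fromℕ (suc m) | x Fin.≟ penultimate m
... | yes x≡top | _         = inj₂ (inj₂ x≡top)
... | no _      | yes x≡sec = inj₂ (inj₁ x≡sec)
... | no x≢top  | no x≢sec  = inj₁ (Fin.≤∧≢⇒< x≤sec x≢sec)
  where
  x≤sec : x ≤ penultimate m
  x≤sec = subst (toℕ x ℕ.≤_) (sym (Fin.toℕ-inject₁ (fromℕ m))) (ℕ.s≤s⁻¹ (<fromℕ x≢top))

penultimate<⇒≡fromℕ : ∀ {m} {x : Fin (2 + m)} → penultimate m < x → x ≡ fromℕ (suc m)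
penultimate<⇒≡fromℕ {m} {x} sec<x with penultimate-cases m x
... | inj₁ x<sec          = ⊥-elim (ℕ.<-asym sec<x x<sec)
... | inj₂ (inj₁ refl)    = ⊥-elim (ℕ.<-irrefl refl sec<x)
... | inj₂ (inj₂ x≡top)   = x≡top

OneLine : ℕ → Set
OneLine n = Vec (Fin n) n

-- Opaque, so that unification recovers p, w and τ from insert p w τ.
opaque
  insert : ∀ {n} → Fin (suc n) → Fin (suc n) → OneLine n → OneLine (suc n)
  insert p w τ = insertAt (map (punchIn w) τ) p w

module _ {n : ℕ} (p w : Fin (suc n)) (τ : OneLine n) where

  opaque
    unfolding insert

    lookup-insert : lookup (insert p w τ) p ≡ w
    lookup-insert = Vec.insertAt-lookup _ p w

    lookup-insert-punchIn : ∀ i → lookup (insert p w τ) (punchIn p i) ≡ punchIn w (lookup τ i)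
    lookup-insert-punchIn i = trans (Vec.insertAt-punchIn _ p w i) (Vec.lookup-map i (punchIn w) τ)

  lookup-insert-punchIn≢ : ∀ i → lookup (insert p w τ) (punchIn p i) ≢ w
  lookup-insert-punchIn≢ i e = Fin.punchInᵢ≢i w (lookup τ i) (trans (sym (lookup-insert-punchIn i)) e)

insert-max : ∀ {n} → OneLine n → OneLine (suc n)
insert-max {n} = insert zero (fromℕ n)

punchIn-view : ∀ {n} (p i : Fin (suc n)) → i ≡ p ⊎ ∃ λ j → i ≡ punchIn p j
punchIn-view p i with i Fin.≟ p
... | yes i≡p = inj₁ i≡p
... | no i≢p = inj₂ (punchOut (i≢p ∘ sym) , sym (Fin.punchIn-punchOut (i≢p ∘ sym)))

insert-isPerm : ∀ {n} {p w : Fin (suc n)} {τ : OneLine n} → IsPerm n τ → IsPerm (suc n) (insert p w τ)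
insert-isPerm {p = p} {w} {τ} τ-perm i j πi≡πj with punchIn-view p i | punchIn-view p j
... | inj₁ refl | inj₁ refl = refl
... | inj₁ refl | inj₂ (j′ , refl) =
  ⊥-elim (lookup-insert-punchIn≢ p w τ j′ (trans (sym πi≡πj) (lookup-insert p w τ)))
... | inj₂ (i′ , refl) | inj₁ refl =
  ⊥-elim (lookup-insert-punchIn≢ p w τ i′ (trans πi≡πj (lookup-insert p w τ)))
... | inj₂ (i′ , refl) | inj₂ (j′ , refl) =
  cong (punchIn p) (τ-perm i′ j′ (Fin.punchIn-injective w _ _
    (trans (sym (lookup-insert-punchIn p w τ i′)) (trans πi≡πj (lookup-insert-punchIn p w τ j′)))))

insert-injective : ∀ {n} {p w : Fin (suc n)} → Injective _≡_ _≡_ (insert p w)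
insert-injective {p = p} {w} {τ} {τ′} e = Pointwise-≡⇒≡ (ext λ i → Fin.punchIn-injective w _ _ (begin
  punchIn w (lookup τ i)               ≡⟨ lookup-insert-punchIn p w τ i ⟨
  lookup (insert p w τ) (punchIn p i)  ≡⟨ cong (λ π → lookup π (punchIn p i)) e ⟩
  lookup (insert p w τ′) (punchIn p i) ≡⟨ lookup-insert-punchIn p w τ′ i ⟩
  punchIn w (lookup τ′ i)             ∎))
  where open ≡-Reasoning

uninsert : ∀ {n} (π : OneLine (suc n)) (p : Fin (suc n)) {w} → IsPerm (suc n) π → lookup π p ≡ w →
           ∃ λ τ → IsPerm n τ × π ≡ insert p w τ
uninsert {n} π p {w} π-perm πp≡w = τ , τ-perm , Pointwise-≡⇒≡ (ext agree)
  where
  w≢ : ∀ i → w ≢ lookup π (punchIn p i)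
  w≢ i e = Fin.punchInᵢ≢i p i (π-perm _ _ (trans (sym e) (sym πp≡w)))
  τ : OneLine n
  τ = tabulate (λ i → punchOut (w≢ i))
  lift : ∀ i → punchIn w (lookup τ i) ≡ lookup π (punchIn p i)
  lift i = trans (cong (punchIn w) (Vec.lookup∘tabulate _ i)) (Fin.punchIn-punchOut (w≢ i))
  τ-perm : IsPerm n τ
  τ-perm i j e = Fin.punchIn-injective p i j (π-perm _ _ (trans (sym (lift i)) (trans (cong (punchIn w) e) (lift j))))
  agree : ∀ k → lookup π k ≡ lookup (insert p w τ) k
  agree k with punchIn-view p k
  ... | inj₁ refl = trans πp≡w (sym (lookup-insert p w τ))
  ... | inj₂ (j , refl) = trans (sym (lift j)) (sym (lookup-insert-punchIn p w τ j))

IsPerm-surjective : ∀ {n} (π : OneLine n) → IsPerm n π → ∀ y → ∃ λ i → lookup π i ≡ y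
IsPerm-surjective {suc n} π π-perm y with Fin.any? (λ i → lookup π i Fin.≟ y)
... | yes hit  = hit
... | no ¬hit = ⊥-elim (Fin.<⇒notInjective (ℕ.n<1+n n) punchOut-injective)
  where
  y≢ : ∀ i → y ≢ lookup π i
  y≢ i y≡πi = ¬hit (i , sym y≡πi)
  punchOut-injective : Injective _≡_ _≡_ (λ i → punchOut (y≢ i))
  punchOut-injective e = π-perm _ _ (Fin.punchOut-injective (y≢ _) (y≢ _) e)

below-max : ∀ {n} (π : OneLine (suc n)) {i t} → IsPerm (suc n) π → lookup π t ≡ fromℕ n → i ≢ t →
            lookup π i < lookup π t
below-max π π-perm πt≡top i≢t =
  subst (_ <_) (sym πt≡top) (<fromℕ (λ πi≡top → i≢t (π-perm _ _ (trans πi≡top (sym πt≡top)))))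

head<⇒0< : ∀ {n} (π : OneLine (suc n)) {t : Fin (suc n)} → lookup π zero < lookup π t → zero {n} < t
head<⇒0< π {zero}  π₀<π₀ = ⊥-elim (ℕ.<-irrefl refl π₀<π₀)
head<⇒0< π {suc t} _     = z<s

Increasing : ∀ {k n} → (Fin k → Fin n) → Set
Increasing ι = ∀ a b → a < b → ι a < ι b

Ascending : ∀ {n} → OneLine n → Set
Ascending τ = Increasing (lookup τ)

Occurrence : ∀ {n k} → OneLine n → OneLine k → (Fin k → Fin n) → Set
Occurrence π σ ι = Increasing ι ×
  (∀ a b → (lookup π (ι a) < lookup π (ι b)) ⇔ (lookup σ a < lookup σ b))

Increasing-≥ : ∀ {k n} {ι : Fin k → Fin n} → Increasing ι → ∀ a → toℕ a ℕ.≤ toℕ (ι a)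
Increasing-≥ inc zero = z≤n
Increasing-≥ {ι = ι} inc (suc a) =
  ℕ.≤-trans (s≤s (Increasing-≥ inc∘inject₁ a))
            (inc (inject₁ a) (suc a) (Fin.≤̄⇒inject₁< ℕ.≤-refl))
  where
  inc∘inject₁ : Increasing (ι ∘ inject₁)
  inc∘inject₁ b c b<c = inc _ _ (subst₂ ℕ._<_ (sym (Fin.toℕ-inject₁ b)) (sym (Fin.toℕ-inject₁ c)) b<c)

Increasing-≢0 : ∀ {k n} {ι : Fin (suc k) → Fin (suc n)} → Increasing ι → ∀ a → ι (suc a) ≢ zero
Increasing-≢0 {ι = ι} inc a ιa≡0 = ℕ.n≮0 (subst (λ i → ι zero < i) ιa≡0 (inc zero (suc a) z<s))

Increasing-≢1 : ∀ {k n} {ι : Fin (2 + k) → Fin (2 + n)} → Increasing ι →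
                ∀ a → ι (suc (suc a)) ≢ suc zero
Increasing-≢1 {ι = ι} inc a ιa≡1
  with subst (λ i → 2 ℕ.≤ toℕ i) ιa≡1 (ℕ.≤-trans (s≤s (s≤s z≤n)) (Increasing-≥ inc _))
... | s≤s ()

Increasing-reflects : ∀ {k n} {φ : Fin k → Fin n} {a b} → Increasing φ → φ a < φ b → a < b
Increasing-reflects {a = a} {b} inc φa<φb with Fin.<-cmp a b
... | tri< a<b _ _ = a<b
... | tri≈ _ refl _ = ⊥-elim (ℕ.<-irrefl refl φa<φb)
... | tri> _ _ b<a = ⊥-elim (ℕ.<-asym φa<φb (inc _ _ b<a))

occurrence : ∀ {n k} (π : OneLine n) (σ : OneLine k) (is vs : Vec (Fin n) k) →
             Linked _<_ is → Linked _<_ vs → (∀ a → lookup π (lookup is a) ≡ lookup vs (lookup σ a)) →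
             Contains π σ
occurrence {n} {k} π σ is vs is↑ vs↑ π∘is≗vs∘σ = lookup is , increasing is↑ , λ a b →
  subst₂ (λ x y → (x < y) ⇔ (lookup σ a < lookup σ b)) (sym (π∘is≗vs∘σ a)) (sym (π∘is≗vs∘σ b))
    (mk⇔ (Increasing-reflects (increasing vs↑)) (increasing vs↑ _ _))
  where
  increasing : ∀ {xs : Vec (Fin n) k} → Linked _<_ xs → Increasing (lookup xs)
  increasing xs↑ a b = Linked.lookup⁺ Fin.<-trans xs↑

module _ {n} (π : OneLine n) (i j k : Fin n) (i<j : i < j) (j<k : j < k) where

  private
    x : Fin n → Fin n
    x = lookup π

  contains-123 : x i < x j → x j < x k → Contains π p123
  contains-123 xi<xj xj<xk = occurrence π p123 (i ∷ j ∷ k ∷ []) (x i ∷ x j ∷ x k ∷ [])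
    (i<j ∷ j<k ∷ [-]) (xi<xj ∷ xj<xk ∷ [-])
    λ { zero → refl ; (suc zero) → refl ; (suc (suc zero)) → refl }

  contains-132 : x i < x k → x k < x j → Contains π p132
  contains-132 xi<xk xk<xj = occurrence π p132 (i ∷ j ∷ k ∷ []) (x i ∷ x k ∷ x j ∷ [])
    (i<j ∷ j<k ∷ [-]) (xi<xk ∷ xk<xj ∷ [-])
    λ { zero → refl ; (suc zero) → refl ; (suc (suc zero)) → refl }

  contains-213 : x j < x i → x i < x k → Contains π p213
  contains-213 xj<xi xi<xk = occurrence π p213 (i ∷ j ∷ k ∷ []) (x j ∷ x i ∷ x k ∷ [])
    (i<j ∷ j<k ∷ [-]) (xj<xi ∷ xi<xk ∷ [-])
    λ { zero → refl ; (suc zero) → refl ; (suc (suc zero)) → refl }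

  contains-3421 : ∀ l → k < l → x l < x k → x k < x i → x i < x j → Contains π p3421
  contains-3421 l k<l xl<xk xk<xi xi<xj =
    occurrence π p3421 (i ∷ j ∷ k ∷ l ∷ []) (x l ∷ x k ∷ x i ∷ x j ∷ [])
    (i<j ∷ j<k ∷ k<l ∷ [-]) (xl<xk ∷ xk<xi ∷ xi<xj ∷ [-])
    λ { zero → refl ; (suc zero) → refl ; (suc (suc zero)) → refl ; (suc (suc (suc zero))) → refl }

Contains-123-or-132 : ∀ {n} (π : OneLine n) {i j k} → i < j → i < k → j ≢ k →
                      lookup π i < lookup π j → lookup π j < lookup π k → Contains π p123 ⊎ Contains π p132
Contains-123-or-132 π {i} {j} {k} i<j i<k j≢k πi<πj πj<πk with Fin.<-cmp j k
... | tri< j<k _ _ = inj₁ (contains-123 π i j k i<j j<k πi<πj πj<πk)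
... | tri≈ _ j≡k _ = ⊥-elim (j≢k j≡k)
... | tri> _ _ k<j = inj₂ (contains-132 π i k j i<k k<j πi<πj πj<πk)

Contains-123-or-213 : ∀ {n} (π : OneLine n) {i j k} → i < j → j < k → lookup π i ≢ lookup π j →
                      lookup π i < lookup π k → lookup π j < lookup π k → Contains π p123 ⊎ Contains π p213
Contains-123-or-213 π {i} {j} {k} i<j j<k πi≢πj πi<πk πj<πk with Fin.<-cmp (lookup π i) (lookup π j)
... | tri< πi<πj _ _ = inj₁ (contains-123 π i j k i<j j<k πi<πj πj<πk)
... | tri≈ _ πi≡πj _ = ⊥-elim (πi≢πj πi≡πj)
... | tri> _ _ πj<πi = inj₂ (contains-213 π i j k i<j j<k πj<πi πi<πk)

Occurrence-cong : ∀ {n k} {π : OneLine n} {σ : OneLine k} {ι ι′ : Fin k → Fin n} →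
                  (∀ a → ι a ≡ ι′ a) → Occurrence π σ ι → Occurrence π σ ι′
Occurrence-cong {π = π} {σ} ι≗ι′ (inc , iso) =
  (λ a b a<b → subst₂ _<_ (ι≗ι′ a) (ι≗ι′ b) (inc a b a<b)) ,
  (λ a b → subst₂ (λ x y → (lookup π x < lookup π y) ⇔ (lookup σ a < lookup σ b))
                  (ι≗ι′ a) (ι≗ι′ b) (iso a b))

occurrence-insert : ∀ {n k} (p w : Fin (suc n)) (τ : OneLine n) (σ : OneLine k) (ι : Fin k → Fin n) →
                    Occurrence τ σ ι ⇔ Occurrence (insert p w τ) σ (punchIn p ∘ ι)
occurrence-insert p w τ σ ι = mk⇔
  (λ (inc , iso) → (λ a b → punchIn-mono-< p ∘ inc a b) ,
                    (λ a b → ⇔.trans (values a b) (iso a b)))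
  (λ (inc , iso) → (λ a b → punchIn-cancel-< p ∘ inc a b) ,
                    (λ a b → ⇔.trans (⇔.sym (values a b)) (iso a b)))
  where
  values : ∀ a b → (lookup (insert p w τ) (punchIn p (ι a)) < lookup (insert p w τ) (punchIn p (ι b))) ⇔
                   (lookup τ (ι a) < lookup τ (ι b))
  values a b = subst₂ (λ x y → (x < y) ⇔ (lookup τ (ι a) < lookup τ (ι b)))
    (sym (lookup-insert-punchIn p w τ (ι a))) (sym (lookup-insert-punchIn p w τ (ι b))) (punchIn-<-⇔ w)

module _ {n k} (p w : Fin (suc n)) (τ : OneLine n) (σ : OneLine k) where

  Avoids-insert⁻ : Avoids (insert p w τ) σ → Avoids τ σ
  Avoids-insert⁻ avoids (ι , occ) = avoids (punchIn p ∘ ι , Equivalence.to (occurrence-insert p w τ σ ι) occ)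

  Avoids-insert : (∀ {ι} a → Occurrence (insert p w τ) σ ι → ι a ≢ p) →
                  Avoids τ σ → Avoids (insert p w τ) σ
  Avoids-insert misses-p τ-avoids (ι , occ) with Fin.any? (λ a → ι a Fin.≟ p)
  ... | yes (a , ιa≡p) = misses-p a occ ιa≡p
  ... | no ¬hits-p = τ-avoids (ι′ , Equivalence.from (occurrence-insert p w τ σ ι′)
                                     (Occurrence-cong {π = insert p w τ} {σ} ι≗punchIn∘ι′ occ))
    where
    p≢ : ∀ a → p ≢ ι a
    p≢ a p≡ιa = ¬hits-p (a , sym p≡ιa)
    ι′ : Fin k → Fin n
    ι′ a = punchOut (p≢ a)
    ι≗punchIn∘ι′ : ∀ a → ι a ≡ punchIn p (ι′ a)
    ι≗punchIn∘ι′ a = sym (Fin.punchIn-punchOut (p≢ a))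

Avoids-short : ∀ {n k} (π : OneLine n) (σ : OneLine (suc k)) → n ℕ.≤ k → Avoids π σ
Avoids-short {k = k} _ _ n≤k (ι , inc , _) = ℕ.<-irrefl refl (ℕ.<-≤-trans (Fin.toℕ<n (ι (fromℕ k)))
  (ℕ.≤-trans n≤k (subst (ℕ._≤ toℕ (ι (fromℕ k))) (Fin.toℕ-fromℕ k)
                        (Increasing-≥ inc (fromℕ k)))))

inserted-max-maximal : ∀ {n k} (p : Fin (suc n)) (τ : OneLine n) (σ : OneLine k) {ι a b} →
                       Occurrence (insert p (fromℕ n) τ) σ ι → ι a ≡ p → ¬ lookup σ a < lookup σ b
inserted-max-maximal {n} p τ σ {ι} {a} {b} (_ , iso) ιa≡p σa<σb =
  fromℕ≮ (subst (_< lookup π (ι b)) (trans (cong (lookup π) ιa≡p) (lookup-insert p (fromℕ n) τ))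
                 (Equivalence.from (iso a b) σa<σb))
  where π = insert p (fromℕ n) τ

Avoids-insert-head : ∀ {n k} (w : Fin (suc n)) (τ : OneLine n) (σ : OneLine (suc k)) →
                     (∀ {ι} → Occurrence (insert zero w τ) σ ι → ι zero ≢ zero) →
                     Avoids τ σ → Avoids (insert zero w τ) σ
Avoids-insert-head w τ σ misses-head = Avoids-insert zero w τ σ λ
  { zero    occ       → misses-head occ
  ; (suc a) (inc , _) → Increasing-≢0 inc a }

Avoids-insert-max : ∀ {n k} (τ : OneLine n) (σ : OneLine (suc k)) b → lookup σ zero < lookup σ b →
                         Avoids τ σ → Avoids (insert-max τ) σ
Avoids-insert-max {n} τ σ b σ₀<σb =
  Avoids-insert-head (fromℕ n) τ σ λ occ ι₀≡0 → inserted-max-maximal zero τ σ occ ι₀≡0 σ₀<σb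

allFin-isPerm : ∀ n → IsPerm n (allFin n)
allFin-isPerm n i j e = trans (sym (Vec.lookup-allFin i)) (trans e (Vec.lookup-allFin j))

allFin-ascending : ∀ n → Ascending (allFin n)
allFin-ascending n i j i<j = subst₂ _<_ (sym (Vec.lookup-allFin i)) (sym (Vec.lookup-allFin j)) i<j

topThenAscending : ∀ m → OneLine (suc m)
topThenAscending m = insert-max (allFin m)

ShortTopThenAscending : ∀ m → OneLine (suc m) → Set
ShortTopThenAscending m π = π ≡ topThenAscending m × m ℕ.≤ 2

ascending-avoiding-123 : ∀ {m} (τ : OneLine m) → Ascending τ → Avoids τ p123 → τ ≡ allFin m × m ℕ.≤ 2
ascending-avoiding-123 []                     _   _ = refl , z≤n
ascending-avoiding-123 (zero ∷ [])              _   _ = refl , s≤s z≤n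
ascending-avoiding-123 (zero ∷ suc zero ∷ [])   _   _ = refl , s≤s (s≤s z≤n)
ascending-avoiding-123 (zero ∷ zero ∷ [])       asc _ with asc zero (suc zero) z<s
... | ()
ascending-avoiding-123 (suc zero ∷ zero ∷ [])     asc _ with asc zero (suc zero) z<s
... | ()
ascending-avoiding-123 (suc zero ∷ suc zero ∷ []) asc _ with asc zero (suc zero) z<s
... | s<s ()
ascending-avoiding-123 τ@(_ ∷ _ ∷ _ ∷ _) asc avoids =
  ⊥-elim (avoids (contains-123 τ zero (suc zero) (suc (suc zero)) z<s (s<s z<s)
                               (asc zero (suc zero) z<s) (asc (suc zero) (suc (suc zero)) (s<s z<s))))

module InS3-Properties (σ₁ σ₂ : OneLine 3) (σ₃ : OneLine 4) where

  InS3-uninsert : ∀ {n} (π : OneLine (suc n)) (p : Fin (suc n)) {w} → InS3 (suc n) σ₁ σ₂ σ₃ π →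
                  lookup π p ≡ w → Image (insert p w) (InS3 n σ₁ σ₂ σ₃) π
  InS3-uninsert π p {w} (π-perm , avoids₁ , avoids₂ , avoids₃) πp≡w with uninsert π p π-perm πp≡w
  ... | τ , τ-perm , refl =
    τ , (τ-perm , Avoids-insert⁻ p w τ σ₁ avoids₁ , Avoids-insert⁻ p w τ σ₂ avoids₂ ,
                  Avoids-insert⁻ p w τ σ₃ avoids₃) ,
    refl

  InS3-short : ∀ {n} (π : OneLine n) → n ℕ.≤ 2 → IsPerm n π → InS3 n σ₁ σ₂ σ₃ π
  InS3-short π n≤2 π-perm =
    π-perm , Avoids-short π σ₁ n≤2 , Avoids-short π σ₂ n≤2 , Avoids-short π σ₃ (ℕ.m≤n⇒m≤1+n n≤2)

  InS3-one : (π : OneLine 1) → InS3 1 σ₁ σ₂ σ₃ π ⇔ π ≡ zero ∷ []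
  InS3-one (zero ∷ []) = mk⇔ (λ _ → refl) (λ _ → InS3-short (allFin 1) (s≤s z≤n) (allFin-isPerm 1))

module Class₁ where

  open InS3-Properties p123 p132 p3421

  S : ∀ n → OneLine n → Set
  S n = InS3 n p123 p132 p3421

  AscendsAfterMax : ∀ {m} → OneLine (suc m) → Set
  AscendsAfterMax {m} τ = ∀ p i j → lookup τ p ≡ fromℕ m → p < i → i < j → lookup τ i < lookup τ j

  T : ∀ m → OneLine (suc m) → Set
  T m τ = S (suc m) τ × AscendsAfterMax τ

  insert-penultimate : ∀ {m} → OneLine (suc m) → OneLine (2 + m)
  insert-penultimate {m} = insert zero (penultimate m)

  insert-penultimate-head≢max : ∀ {m} (τ : OneLine (suc m)) → lookup (insert-penultimate τ) zero ≢ fromℕ (suc m)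
  insert-penultimate-head≢max {m} τ = penultimate≢fromℕ m ∘ trans (sym (lookup-insert zero (penultimate m) τ))

  S-insert-max : ∀ {n} (τ : OneLine n) → S n τ → S (suc n) (insert-max τ)
  S-insert-max τ (τ-perm , avoids-123 , avoids-132 , avoids-3421) =
    insert-isPerm τ-perm ,
    Avoids-insert-max τ p123 (suc zero) z<s avoids-123 ,
    Avoids-insert-max τ p132 (suc zero) z<s avoids-132 ,
    Avoids-insert-max τ p3421 (suc zero) (s<s (s<s z<s)) avoids-3421

  S-head : ∀ {m} (π : OneLine (2 + m)) → S (2 + m) π →
           lookup π zero ≡ fromℕ (suc m) ⊎ lookup π zero ≡ penultimate m
  S-head {m} π (π-perm , avoids-123 , avoids-132 , _) with penultimate-cases m (lookup π zero)
  ... | inj₂ (inj₂ π₀≡top)    = inj₁ π₀≡top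
  ... | inj₂ (inj₁ π₀≡penultimate) = inj₂ π₀≡penultimate
  ... | inj₁ π₀<penultimate
    with IsPerm-surjective π π-perm (penultimate m) | IsPerm-surjective π π-perm (fromℕ (suc m))
  ...   | s , πs≡penultimate | t , πt≡top =
    ⊥-elim ([ avoids-123 , avoids-132 ]
      (Contains-123-or-132 π (head<⇒0< π π₀<πs) (head<⇒0< π (Fin.<-trans π₀<πs πs<πt))
                             s≢t π₀<πs πs<πt))
    where
    π₀<πs : lookup π zero < lookup π s
    π₀<πs = subst (lookup π zero <_) (sym πs≡penultimate) π₀<penultimate
    πs<πt : lookup π s < lookup π t
    πs<πt = subst₂ _<_ (sym πs≡penultimate) (sym πt≡top) (penultimate<fromℕ m)
    s≢t : s ≢ t
    s≢t refl = penultimate≢fromℕ m (trans (sym πs≡penultimate) πt≡top)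

  module _ {m : ℕ} (τ : OneLine m) where

    private
      π : OneLine (suc m)
      π = insert-max τ

      lookup-π-suc : ∀ k → lookup π (suc k) ≡ punchIn (fromℕ m) (lookup τ k)
      lookup-π-suc = lookup-insert-punchIn zero (fromℕ m) τ

    AscendsAfterMax-insert-max⁻ : AscendsAfterMax π → Ascending τ
    AscendsAfterMax-insert-max⁻ asc i j i<j =
      punchIn-cancel-< (fromℕ m) (subst₂ _<_ (lookup-π-suc i) (lookup-π-suc j)
        (asc zero (suc i) (suc j) (lookup-insert zero (fromℕ m) τ) z<s (s<s i<j)))

    AscendsAfterMax-insert-max : Ascending τ → AscendsAfterMax π
    AscendsAfterMax-insert-max asc zero (suc i) (suc j) _ _ (s<s i<j) =
      subst₂ _<_ (sym (lookup-π-suc i)) (sym (lookup-π-suc j)) (punchIn-mono-< (fromℕ m) (asc i j i<j))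
    AscendsAfterMax-insert-max asc (suc p) _ _ πp≡top =
      ⊥-elim (lookup-insert-punchIn≢ zero (fromℕ m) τ p πp≡top)

  module _ {m : ℕ} (τ : OneLine (suc m)) where

    private
      π : OneLine (2 + m)
      π = insert-penultimate τ

      lookup-π-zero : lookup π zero ≡ penultimate m
      lookup-π-zero = lookup-insert zero (penultimate m) τ

      lookup-π-suc : ∀ k → lookup π (suc k) ≡ punchIn (penultimate m) (lookup τ k)
      lookup-π-suc = lookup-insert-punchIn zero (penultimate m) τ

      above-head-is-max : ∀ {x} → lookup π zero < x → x ≡ fromℕ (suc m)
      above-head-is-max = penultimate<⇒≡fromℕ ∘ subst (_< _) lookup-π-zero

    AscendsAfterMax-insert-penultimate : AscendsAfterMax τ → AscendsAfterMax π
    AscendsAfterMax-insert-penultimate asc zero i j π₀≡top =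
      ⊥-elim (penultimate≢fromℕ m (trans (sym lookup-π-zero) π₀≡top))
    AscendsAfterMax-insert-penultimate asc (suc p) (suc i) (suc j) πp≡top (s<s p<i) (s<s i<j) =
      subst₂ _<_ (sym (lookup-π-suc i)) (sym (lookup-π-suc j))
        (punchIn-mono-< (penultimate m) (asc p i j τp≡top p<i i<j))
      where
      τp≡top : lookup τ p ≡ fromℕ m
      τp≡top = punchIn≡fromℕ⇒ (penultimate m) (trans (sym (lookup-π-suc p)) πp≡top)

    AscendsAfterMax-of-avoiding-3421 : IsPerm (suc m) τ → Avoids π p3421 → AscendsAfterMax τ
    AscendsAfterMax-of-avoiding-3421 τ-perm avoids p i j τp≡top p<i i<j with Fin.<-cmp (lookup τ i) (lookup τ j)
    ... | tri< τi<τj _ _ = τi<τj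
    ... | tri≈ _ τi≡τj _ = ⊥-elim (Fin.<⇒≢ i<j (τ-perm i j τi≡τj))
    ... | tri> _ _ τj<τi =
      ⊥-elim (avoids (contains-3421 π zero (suc p) (suc i) z<s (s<s p<i) (suc j) (s<s i<j)
                                    πj<πi πi<π₀ π₀<πp))
      where
      πj<πi : lookup π (suc j) < lookup π (suc i)
      πj<πi = subst₂ _<_ (sym (lookup-π-suc j)) (sym (lookup-π-suc i)) (punchIn-mono-< (penultimate m) τj<τi)
      τi<penultimate : toℕ (lookup τ i) ℕ.< toℕ (penultimate m)
      τi<penultimate = subst (toℕ (lookup τ i) ℕ.<_) (sym (Fin.toℕ-inject₁ (fromℕ m)))
                    (<fromℕ (λ τi≡top → Fin.<⇒≢ p<i (τ-perm p i (trans τp≡top (sym τi≡top)))))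
      πi<π₀ : lookup π (suc i) < lookup π zero
      πi<π₀ = subst₂ _<_ (sym (lookup-π-suc i)) (sym lookup-π-zero) (punchIn-below τi<penultimate)
      π₀<πp : lookup π zero < lookup π (suc p)
      π₀<πp = subst₂ _<_ (sym lookup-π-zero) (sym (lookup-π-suc p))
                (punchIn-above
                  (ℕ.≤-reflexive (trans (Fin.toℕ-inject₁ (fromℕ m)) (cong toℕ (sym τp≡top)))))

    Avoids-insert-penultimate : ∀ (σ : OneLine 3) → IsPerm (suc m) τ →
                           lookup σ zero < lookup σ (suc zero) → lookup σ zero < lookup σ (suc (suc zero)) →
                           Avoids τ σ → Avoids π σ
    Avoids-insert-penultimate σ τ-perm σ₀<σ₁ σ₀<σ₂ =
      Avoids-insert-head (penultimate m) τ σ λ {ι} (inc , iso) ι₀≡0 →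
      let is-top : ∀ b → lookup σ zero < lookup σ b → lookup π (ι b) ≡ fromℕ (suc m)
          is-top b σ₀<σb = above-head-is-max (subst (λ i → lookup π i < lookup π (ι b)) ι₀≡0
                                                (Equivalence.from (iso zero b) σ₀<σb))
      in Fin.<⇒≢ (inc (suc zero) (suc (suc zero)) (s<s z<s))
           (insert-isPerm τ-perm _ _
             (trans (is-top (suc zero) σ₀<σ₁) (sym (is-top (suc (suc zero)) σ₀<σ₂))))

    Avoids-3421-insert-penultimate : AscendsAfterMax τ → Avoids τ p3421 → Avoids π p3421
    Avoids-3421-insert-penultimate asc = Avoids-insert-head (penultimate m) τ p3421 λ {ι} (inc , iso) ι₀≡0 →
      let π₁≡top : lookup π (ι (suc zero)) ≡ fromℕ (suc m)
          π₁≡top = above-head-is-max (subst (λ i → lookup π i < lookup π (ι (suc zero))) ι₀≡0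
                                        (Equivalence.from (iso zero (suc zero)) (s<s (s<s z<s))))
      in ℕ.<-asym (AscendsAfterMax-insert-penultimate asc _ _ _ π₁≡top
                     (inc _ _ (s<s z<s)) (inc _ _ (s<s (s<s z<s))))
                  (Equivalence.from (iso (suc (suc (suc zero))) (suc (suc zero))) z<s)

    S-insert-penultimate : T m τ → S (2 + m) π
    S-insert-penultimate ((τ-perm , avoids-123 , avoids-132 , avoids-3421) , asc) =
      insert-isPerm τ-perm ,
      Avoids-insert-penultimate p123 τ-perm z<s z<s avoids-123 ,
      Avoids-insert-penultimate p132 τ-perm z<s z<s avoids-132 ,
      Avoids-3421-insert-penultimate asc avoids-3421

  S-uninsert-penultimate : ∀ {m} (π : OneLine (2 + m)) → S (2 + m) π → lookup π zero ≡ penultimate m →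
                      Image insert-penultimate (T m) π
  S-uninsert-penultimate π f@(_ , _ , _ , avoids-3421) π₀≡penultimate
    with InS3-uninsert π zero f π₀≡penultimate
  ... | τ , fτ@(τ-perm , _) , refl = τ , (fτ , AscendsAfterMax-of-avoiding-3421 τ τ-perm avoids-3421) , refl

  S-split : ∀ m π → S (2 + m) π ⇔ (Image insert-max (S (suc m)) π ⊎ Image insert-penultimate (T m) π)
  S-split m π = mk⇔
    (λ f → map-⊎ (InS3-uninsert π zero f) (S-uninsert-penultimate π f) (S-head π f))
    λ { (inj₁ (τ , fτ , refl)) → S-insert-max τ fτ
      ; (inj₂ (τ , tτ , refl)) → S-insert-penultimate τ tτ }

  S-one : ∀ π → S 1 π ⇔ π ≡ zero ∷ []
  S-one = InS3-one

  T-zero : ∀ π → T 0 π ⇔ π ≡ zero ∷ []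
  T-zero π = ⇔.trans (mk⇔ proj₁ (_, λ { zero zero _ _ () })) (InS3-one π)

  T-split : ∀ m π → T (suc m) π ⇔ (ShortTopThenAscending (suc m) π ⊎ Image insert-penultimate (T m) π)
  T-split m π = mk⇔ to from
    where
    to : T (suc m) π → ShortTopThenAscending (suc m) π ⊎ Image insert-penultimate (T m) π
    to (f , asc) with S-head π f
    ... | inj₂ π₀≡penultimate = inj₂ (S-uninsert-penultimate π f π₀≡penultimate)
    ... | inj₁ π₀≡top with InS3-uninsert π zero f π₀≡top
    ...   | τ , (_ , avoids-123 , _) , refl
      with ascending-avoiding-123 τ (AscendsAfterMax-insert-max⁻ τ asc) avoids-123
    ...     | refl , m≤2 = inj₁ (refl , m≤2)
    from : ShortTopThenAscending (suc m) π ⊎ Image insert-penultimate (T m) π → T (suc m) π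
    from (inj₁ (refl , m≤2)) = S-insert-max (allFin _) (InS3-short (allFin _) m≤2 (allFin-isPerm _)) ,
                               AscendsAfterMax-insert-max (allFin _) (allFin-ascending _)
    from (inj₂ (τ , tτ@(_ , asc) , refl)) = S-insert-penultimate τ tτ , AscendsAfterMax-insert-penultimate τ asc

module Class₂ where

  open InS3-Properties p123 p213 p3421

  S : ∀ n → OneLine n → Set
  S n = InS3 n p123 p213 p3421

  AscendsBelowHead : ∀ {n} → OneLine (suc n) → Set
  AscendsBelowHead {n} τ = ∀ i j → zero {n} < i → i < j →
    lookup τ i < lookup τ zero → lookup τ j < lookup τ zero → lookup τ i < lookup τ j

  T : ∀ m → OneLine (suc m) → Set
  T m τ = S (suc m) τ × AscendsBelowHead τ

  insert-max-at-1 : ∀ {m} → OneLine (suc m) → OneLine (2 + m)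
  insert-max-at-1 {m} = insert (suc zero) (fromℕ (suc m))

  insert-max-at-1-head≢max : ∀ {m} (τ : OneLine (suc m)) → lookup (insert-max-at-1 τ) zero ≢ fromℕ (suc m)
  insert-max-at-1-head≢max {m} τ = lookup-insert-punchIn≢ (suc zero) (fromℕ (suc m)) τ zero

  S-insert-max : ∀ {n} (τ : OneLine n) → S n τ → S (suc n) (insert-max τ)
  S-insert-max τ (τ-perm , avoids-123 , avoids-213 , avoids-3421) =
    insert-isPerm τ-perm ,
    Avoids-insert-max τ p123 (suc zero) z<s avoids-123 ,
    Avoids-insert-max τ p213 (suc (suc zero)) (s<s z<s) avoids-213 ,
    Avoids-insert-max τ p3421 (suc zero) (s<s (s<s z<s)) avoids-3421

  S-head : ∀ {m} (π : OneLine (2 + m)) → S (2 + m) π →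
           lookup π zero ≡ fromℕ (suc m) ⊎ lookup π (suc zero) ≡ fromℕ (suc m)
  S-head {m} π (π-perm , avoids-123 , avoids-213 , _) with IsPerm-surjective π π-perm (fromℕ (suc m))
  ... | zero , π₀≡top = inj₁ π₀≡top
  ... | suc zero , π₁≡top = inj₂ π₁≡top
  ... | suc (suc t) , πt≡top =
    ⊥-elim ([ avoids-123 , avoids-213 ] (Contains-123-or-213 π {zero} {suc zero} {suc (suc t)} z<s (s<s z<s)
      (λ π₀≡π₁ → Fin.0≢1+n (π-perm _ _ π₀≡π₁))
      (below-max π π-perm πt≡top λ ()) (below-max π π-perm πt≡top λ ())))

  module _ {m : ℕ} (τ : OneLine m) where

    private
      π : OneLine (suc m)
      π = insert-max τ

      lookup-π-suc : ∀ k → lookup π (suc k) ≡ punchIn (fromℕ m) (lookup τ k)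
      lookup-π-suc = lookup-insert-punchIn zero (fromℕ m) τ

    AscendsBelowHead-insert-max⁻ : AscendsBelowHead π → Ascending τ
    AscendsBelowHead-insert-max⁻ asc i j i<j =
      punchIn-cancel-< (fromℕ m) (subst₂ _<_ (lookup-π-suc i) (lookup-π-suc j)
        (asc (suc i) (suc j) z<s (s<s i<j) (below-head i) (below-head j)))
      where
      below-head : ∀ k → lookup π (suc k) < lookup π zero
      below-head k = subst₂ _<_ (sym (lookup-π-suc k)) (sym (lookup-insert zero (fromℕ m) τ))
                       (<fromℕ (Fin.punchInᵢ≢i _ _))

    AscendsBelowHead-insert-max : Ascending τ → AscendsBelowHead π
    AscendsBelowHead-insert-max asc (suc i) (suc j) _ (s<s i<j) _ _ =
      subst₂ _<_ (sym (lookup-π-suc i)) (sym (lookup-π-suc j)) (punchIn-mono-< (fromℕ m) (asc i j i<j))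

  module _ {m : ℕ} (τ : OneLine (suc m)) where

    private
      top : Fin (2 + m)
      top = fromℕ (suc m)

      π : OneLine (2 + m)
      π = insert-max-at-1 τ

      lookup-π-1 : lookup π (suc zero) ≡ top
      lookup-π-1 = lookup-insert (suc zero) top τ

      lookup-π-punchIn : ∀ k → lookup π (punchIn (suc zero) k) ≡ punchIn top (lookup τ k)
      lookup-π-punchIn = lookup-insert-punchIn (suc zero) top τ

    AscendsBelowHead-insert-max-at-1 : AscendsBelowHead τ → AscendsBelowHead π
    AscendsBelowHead-insert-max-at-1 asc (suc zero) _ _ _ π₁<π₀ _ =
      ⊥-elim (fromℕ≮ (subst (_< lookup π zero) lookup-π-1 π₁<π₀))
    AscendsBelowHead-insert-max-at-1 asc (suc (suc i)) (suc (suc j)) _ (s<s i<j) πi<π₀ πj<π₀ =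
      subst₂ _<_ (sym (lookup-π-punchIn (suc i))) (sym (lookup-π-punchIn (suc j)))
        (punchIn-mono-< top (asc (suc i) (suc j) z<s i<j (below-head (suc i) πi<π₀) (below-head (suc j) πj<π₀)))
      where
      below-head : ∀ k → lookup π (punchIn (suc zero) k) < lookup π zero → lookup τ k < lookup τ zero
      below-head k lt = punchIn-cancel-< top (subst₂ _<_ (lookup-π-punchIn k) (lookup-π-punchIn zero) lt)

    AscendsBelowHead-of-avoiding-3421 : IsPerm (suc m) τ → Avoids π p3421 → AscendsBelowHead τ
    AscendsBelowHead-of-avoiding-3421 τ-perm avoids (suc i) j _ i<j τi<τ₀ τj<τ₀
      with Fin.<-cmp (lookup τ (suc i)) (lookup τ j)
    ... | tri< τi<τj _ _ = τi<τj
    ... | tri≈ _ τi≡τj _ = ⊥-elim (Fin.<⇒≢ i<j (τ-perm _ _ τi≡τj))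
    ... | tri> _ _ τj<τi = ⊥-elim (avoids (contains-3421 π zero (suc zero) (suc (suc i)) z<s (s<s z<s)
                                     (punchIn (suc zero) j) (punchIn-mono-< (suc zero) i<j) πj<πi πi<π₀ π₀<π₁))
      where
      πj<πi : lookup π (punchIn (suc zero) j) < lookup π (suc (suc i))
      πj<πi = subst₂ _<_ (sym (lookup-π-punchIn j)) (sym (lookup-π-punchIn (suc i))) (punchIn-mono-< top τj<τi)
      πi<π₀ : lookup π (suc (suc i)) < lookup π zero
      πi<π₀ = subst₂ _<_ (sym (lookup-π-punchIn (suc i))) (sym (lookup-π-punchIn zero))
                (punchIn-mono-< top τi<τ₀)
      π₀<π₁ : lookup π zero < lookup π (suc zero)
      π₀<π₁ = subst₂ _<_ (sym (lookup-π-punchIn zero)) (sym lookup-π-1) (<fromℕ (Fin.punchInᵢ≢i _ _))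

    Avoids-insert-max-at-1 : ∀ (σ : OneLine 3) →
                             lookup σ zero < lookup σ (suc (suc zero)) →
                             lookup σ (suc zero) < lookup σ (suc (suc zero)) →
                             Avoids τ σ → Avoids π σ
    Avoids-insert-max-at-1 σ σ₀<σ₂ σ₁<σ₂ = Avoids-insert (suc zero) top τ σ λ
      { zero             occ       ι₀≡1 → inserted-max-maximal (suc zero) τ σ occ ι₀≡1 σ₀<σ₂
      ; (suc zero)       occ       ι₁≡1 → inserted-max-maximal (suc zero) τ σ occ ι₁≡1 σ₁<σ₂
      ; (suc (suc zero)) (inc , _)      → Increasing-≢1 inc zero }

    Avoids-3421-insert-max-at-1 : AscendsBelowHead τ → Avoids τ p3421 → Avoids π p3421
    Avoids-3421-insert-max-at-1 asc = Avoids-insert (suc zero) top τ p3421 λ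
      { zero          occ       ι₀≡1 →
          inserted-max-maximal (suc zero) τ p3421 {b = suc zero} occ ι₀≡1 (s<s (s<s z<s))
      ; (suc zero)    occ       ι₁≡1 → misses-1 occ ι₁≡1
      ; (suc (suc a)) (inc , _)      → Increasing-≢1 inc a }
      where
      misses-1 : ∀ {ι} → Occurrence π p3421 ι → ι (suc zero) ≢ suc zero
      misses-1 {ι} (inc , iso) ι₁≡1 =
        ℕ.<-asym (AscendsBelowHead-insert-max-at-1 asc (ι (suc (suc zero))) (ι (suc (suc (suc zero))))
                    (ℕ.≤-<-trans z≤n (inc zero (suc (suc zero)) z<s)) (inc _ _ (s<s (s<s z<s)))
                    (below-head (suc (suc zero)) (s<s z<s)) (below-head (suc (suc (suc zero))) z<s))
                 (Equivalence.from (iso (suc (suc (suc zero))) (suc (suc zero))) z<s)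
        where
        ι₀≡0 : ι zero ≡ zero
        ι₀≡0 = Fin.toℕ-injective (ℕ.n<1⇒n≡0 (subst (ι zero <_) ι₁≡1 (inc zero (suc zero) z<s)))
        below-head : ∀ b → lookup p3421 b < lookup p3421 zero → lookup π (ι b) < lookup π zero
        below-head b σb<σ₀ =
          subst (λ i → lookup π (ι b) < lookup π i) ι₀≡0 (Equivalence.from (iso b zero) σb<σ₀)

    S-insert-max-at-1 : T m τ → S (2 + m) π
    S-insert-max-at-1 ((τ-perm , avoids-123 , avoids-213 , avoids-3421) , asc) =
      insert-isPerm τ-perm ,
      Avoids-insert-max-at-1 p123 z<s (s<s z<s) avoids-123 ,
      Avoids-insert-max-at-1 p213 (s<s z<s) z<s avoids-213 ,
      Avoids-3421-insert-max-at-1 asc avoids-3421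

  S-uninsert-max-at-1 : ∀ {m} (π : OneLine (2 + m)) → S (2 + m) π → lookup π (suc zero) ≡ fromℕ (suc m) →
                        Image insert-max-at-1 (T m) π
  S-uninsert-max-at-1 π f@(_ , _ , _ , avoids-3421) π₁≡top with InS3-uninsert π (suc zero) f π₁≡top
  ... | τ , fτ@(τ-perm , _) , refl = τ , (fτ , AscendsBelowHead-of-avoiding-3421 τ τ-perm avoids-3421) , refl

  S-split : ∀ m π → S (2 + m) π ⇔
            (Image insert-max (S (suc m)) π ⊎ Image insert-max-at-1 (T m) π)
  S-split m π = mk⇔
    (λ f → map-⊎ (InS3-uninsert π zero f) (S-uninsert-max-at-1 π f) (S-head π f))
    λ { (inj₁ (τ , fτ , refl)) → S-insert-max τ fτ
      ; (inj₂ (τ , tτ , refl)) → S-insert-max-at-1 τ tτ }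

  S-one : ∀ π → S 1 π ⇔ π ≡ zero ∷ []
  S-one = InS3-one

  T-zero : ∀ π → T 0 π ⇔ π ≡ zero ∷ []
  T-zero π = ⇔.trans (mk⇔ proj₁ (_, λ { zero _ () })) (InS3-one π)

  T-split : ∀ m π → T (suc m) π ⇔
            (ShortTopThenAscending (suc m) π ⊎ Image insert-max-at-1 (T m) π)
  T-split m π = mk⇔ to from
    where
    to : T (suc m) π → ShortTopThenAscending (suc m) π ⊎ Image insert-max-at-1 (T m) π
    to (f , asc) with S-head π f
    ... | inj₂ π₁≡top = inj₂ (S-uninsert-max-at-1 π f π₁≡top)
    ... | inj₁ π₀≡top with InS3-uninsert π zero f π₀≡top
    ...   | τ , (_ , avoids-123 , _) , refl
      with ascending-avoiding-123 τ (AscendsBelowHead-insert-max⁻ τ asc) avoids-123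
    ...     | refl , m≤2 = inj₁ (refl , m≤2)
    from : ShortTopThenAscending (suc m) π ⊎ Image insert-max-at-1 (T m) π → T (suc m) π
    from (inj₁ (refl , m≤2)) = S-insert-max (allFin _) (InS3-short (allFin _) m≤2 (allFin-isPerm _)) ,
                               AscendsBelowHead-insert-max (allFin _) (allFin-ascending _)
    from (inj₂ (τ , tτ@(_ , asc) , refl)) = S-insert-max-at-1 τ tτ , AscendsBelowHead-insert-max-at-1 τ asc

module Counting
  (S : ∀ n → OneLine n → Set)
  (T : ∀ m → OneLine (suc m) → Set)
  (g : ∀ {m} → OneLine (suc m) → OneLine (2 + m))
  (g-injective : ∀ {m} → Injective _≡_ _≡_ (g {m}))
  (g-head : ∀ {m} (τ : OneLine (suc m)) → lookup (g τ) zero ≢ fromℕ (suc m))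
  (S-one : ∀ π → S 1 π ⇔ π ≡ zero ∷ [])
  (T-zero : ∀ π → T 0 π ⇔ π ≡ zero ∷ [])
  (S-split : ∀ m π → S (2 + m) π ⇔ (Image insert-max (S (suc m)) π ⊎ Image g (T m) π))
  (T-split : ∀ m π → T (suc m) π ⇔ (ShortTopThenAscending (suc m) π ⊎ Image g (T m) π))
  where

  private
    max-head≢g : ∀ {m} {π : OneLine (2 + m)} (τ : OneLine (suc m)) →
                 lookup π zero ≡ fromℕ (suc m) → π ≢ g τ
    max-head≢g τ π₀≡top refl = g-head τ π₀≡top

  T-step : ∀ {m t c} → HasCard (ShortTopThenAscending (suc m)) t → HasCard (T m) c →
           HasCard (T (suc m)) (t + c)
  T-step {m} top-card T-card =
    HasCard-cong (λ π → ⇔.sym (T-split m π)) (HasCard-⊎ disjoint top-card (HasCard-Image g-injective T-card))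
    where
    disjoint : ∀ π → ShortTopThenAscending (suc m) π → Image g (T m) π → ⊥
    disjoint π (refl , _) (τ , _ , π≡gτ) =
      max-head≢g τ (lookup-insert zero (fromℕ (suc m)) (allFin (suc m))) π≡gτ

  S-step : ∀ {m a b} → HasCard (S (suc m)) a → HasCard (T m) b → HasCard (S (2 + m)) (a + b)
  S-step {m} S-card T-card = HasCard-cong (λ π → ⇔.sym (S-split m π))
    (HasCard-⊎ disjoint (HasCard-Image insert-injective S-card) (HasCard-Image g-injective T-card))
    where
    disjoint : ∀ π → Image insert-max (S (suc m)) π → Image g (T m) π → ⊥
    disjoint π (ρ , _ , refl) (τ , _ , π≡gτ) = max-head≢g τ (lookup-insert zero (fromℕ (suc m)) ρ) π≡gτ

  S-one-card : HasCard (S 1) 1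
  S-one-card = HasCard-cong (λ π → ⇔.sym (S-one π)) (HasCard-≡ (zero ∷ []))

  T-zero-card : HasCard (T 0) 1
  T-zero-card = HasCard-cong (λ π → ⇔.sym (T-zero π)) (HasCard-≡ (zero ∷ []))

  T-one-card : HasCard (T 1) 2
  T-one-card = T-step (HasCard-≡× _ (s≤s z≤n)) T-zero-card

  T-card : ∀ k → HasCard (T (2 + k)) 3
  T-card zero    = T-step (HasCard-≡× _ (s≤s (s≤s z≤n))) T-one-card
  T-card (suc k) = T-step (HasCard-∅ λ { _ (_ , s≤s (s≤s ())) }) (T-card k)

  S-card : ∀ k → HasCard (S (3 + k)) (4 + 3 * k)
  S-card zero    = S-step (S-step S-one-card T-zero-card) T-one-card
  S-card (suc k) = subst (HasCard (S (4 + k))) (cong (4 +_) (trans (ℕ.+-comm (3 * k) 3) (sym (ℕ.*-suc 3 k))))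
                         (S-step (S-card k) (T-card k))

module Count₁ = Counting Class₁.S Class₁.T Class₁.insert-penultimate insert-injective
  Class₁.insert-penultimate-head≢max Class₁.S-one Class₁.T-zero Class₁.S-split Class₁.T-split

module Count₂ = Counting Class₂.S Class₂.T Class₂.insert-max-at-1 insert-injective
  Class₂.insert-max-at-1-head≢max Class₂.S-one Class₂.T-zero Class₂.S-split Class₂.T-split

theorem3p5 : (n : ℕ) → 3 ℕ.≤ n →
    HasCard (InS3 n p123 p132 p3421) (3 * n ∸ 5) ×
    HasCard (InS3 n p123 p213 p3421) (3 * n ∸ 5)
theorem3p5 (suc zero)          (s≤s ())
theorem3p5 (suc (suc zero))    (s≤s (s≤s ()))
theorem3p5 (suc (suc (suc k))) _ = 3n∸5 (Count₁.S-card k) , 3n∸5 (Count₂.S-card k)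
  where
  3n∸5 : ∀ {P : OneLine (3 + k) → Set} → HasCard P (4 + 3 * k) → HasCard P (3 * (3 + k) ∸ 5)
  3n∸5 = subst (HasCard _) (cong (_∸ 5) (sym (ℕ.*-distribˡ-+ 3 3 k)))
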